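{- Let $H$ be an $r$-uniform hypergraph on $n$ vertices and $k\ge1$ an integer. Then $f(H,1,k)\ge \chi(H)-r(r(k-1)+1)$. For $r=2$ this bound is sharp: there are graphs attaining equality.
   Context: $\chi(H)$ is the chromatic number of $H$: the minimum number of colors in a vertex coloring with no monochromatic edge. An orientation $D$ of $H$ assigns to each edge a linear ordering of its $r$ vertices (positions $1,\dots,r$); $\deg_i(v)$ is the number of edges in which $v$ occupies position $i$. $f(H,1,k)$ is the minimum over all orientations of the number of vertices $v$ with $\deg_i(v)\ge k$ for all $1\le i\le r$. -}

module Defs where

open import Data.Nat using (ℕ; _≤_; _≤?_)
open import Data.Fin using (Fin; _≟_)
open import Data.Fin.Subset using (Subset; _∈_; ∣_∣)
open import Data.Fin.Properties using (all?)
open import Data.List using (length; filter; allFin)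
open import Data.Product using (Σ; ∃; _×_; _,_)
open import Function.Definitions using (Injective)
open import Relation.Binary.PropositionalEquality using (_≡_)
open import Relation.Nullary using (¬_)
open import Function.Bundles using (_⇔_)

record Hypergraph (r n : ℕ) : Set where
  field
    m       : ℕ
    edge    : Fin m → Subset n
    distinct : Injective _≡_ _≡_ edge
    uniform : ∀ e → ∣ edge e ∣ ≡ r
open Hypergraph public

Monochromatic : ∀ {r n c} (H : Hypergraph r n) → (Fin n → Fin c) → Fin (m H) → Set
Monochromatic H col e = ∀ u v → u ∈ edge H e → v ∈ edge H e → col u ≡ col v

ProperColouring : ∀ {r n c} (H : Hypergraph r n) → (Fin n → Fin c) → Set
ProperColouring H col = ∀ e → ¬ Monochromatic H col e

Colourable : ∀ {r n} → Hypergraph r n → ℕ → Set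
Colourable {n = n} H c = Σ (Fin n → Fin c) λ col → ProperColouring H col

IsChromaticNumber : ∀ {r n} → Hypergraph r n → ℕ → Set
IsChromaticNumber H c = Colourable H c × (∀ c′ → Colourable H c′ → c ≤ c′)

-- Orientations: each edge gets a linear ordering of its r vertices,
-- i.e. a bijection from positions Fin r onto the edge.

record Orientation {r n} (H : Hypergraph r n) : Set where
  field
    pos      : Fin (m H) → Fin r → Fin n
    pos-inj  : ∀ e → Injective _≡_ _≡_ (pos e)
    pos-onto : ∀ e v → (v ∈ edge H e) ⇔ (∃ λ i → pos e i ≡ v)
open Orientation public

deg : ∀ {r n} {H : Hypergraph r n} → Orientation H → Fin r → Fin n → ℕ
deg {H = H} D i v = length (filter (λ e → pos D e i ≟ v) (allFin (m H)))

countRich : ∀ {r n} {H : Hypergraph r n} → Orientation H → ℕ → ℕ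
countRich {n = n} D k =
  length (filter (λ v → all? (λ i → k ≤? deg D i v)) (allFin n))

IsF1 : ∀ {r n} → Hypergraph r n → ℕ → ℕ → Set
IsF1 H k t =
  (Σ (Orientation H) λ D → countRich D k ≡ t) ×
  (∀ (D : Orientation H) → t ≤ countRich D k)

module Submission where

-- Fix an orientation D attaining f(H,1,k) and let d = k − 1.  The f rich vertices receive
-- pairwise distinct colours.  Every other vertex v has a position i with deg_i(v) ≤ d; sending
-- v to the vertex at a second position of each edge in which v sits at position i gives a
-- digraph of out-degree at most d.  Its in-degrees average at most d, so it is 2d-degenerate
-- and has a proper colouring with 2d + 1 ≤ r·d + 1 colours; v is coloured by the pair
-- (i, its colour there).  An edge whose vertices all receive the same pair (i, x) contains an
-- arc of that digraph, which is impossible.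
--
-- For sharpness take the complete graph on two copies A, B of ℤ/(2d + 1), orient every edge
-- from A to B, and inside each copy orient y − s → y for 1 ≤ s ≤ d.  Then every vertex of A
-- has in-degree d and every vertex of B has out-degree d, so no vertex is rich, while the
-- chromatic number is 2(2d + 1).

open import Defs
open import Data.Bool using (Bool; true; false; _∧_)
open import Data.Empty using (⊥; ⊥-elim)
open import Data.Fin using (Fin; zero; suc; _≟_; toℕ; fromℕ<; join; splitAt; combine; remQuot)
open import Data.Fin.Properties
  using (all?; ¬∀⟶∃¬; injective⇒≤; pigeonhole; <⇒≢; toℕ<n; toℕ-fromℕ<; toℕ-injective;
         splitAt-join; join-splitAt; remQuot-combine; +↔⊎; *↔×)
open import Data.Fin.Subset using (Subset; ⊤; ⁅_⁆; _∪_; ∣_∣; _-_)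
  renaming (_∈_ to _∈ₛ_; _∉_ to _∉ₛ_)
open import Data.Fin.Subset.Properties
  using (∈⊤; ∣p∣≤n; x∈p⇒∣p-x∣<∣p∣; x∈p∧x∉q⇒x∈p─q; x∈⁅x⁆; x∈⁅y⁆⇒x≡y; x∈p∪q⁻; x∈p∪q⁺;
         ∪-identityˡ; ∪-identityʳ; ∣⁅x⁆∣≡1)
  renaming (_∈?_ to _∈ₛ?_)
open import Data.List using (List; []; length; filter; tabulate; allFin; lookup; map; _++_)
open import Data.List.Properties using (length-++; length-map; filter-none)
open import Data.List.Membership.Propositional using (_∈_; _∉_)
open import Data.List.Membership.Propositional.Properties
  using (∈-lookup; ∈-filter⁺; ∈-filter⁻; ∈-allFin; ∈-map⁺; ∈-++⁺ˡ; ∈-++⁺ʳ)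
open import Data.List.Membership.Setoid.Properties using (index-injective)
open import Data.List.Relation.Unary.All as All using ()
open import Data.List.Relation.Unary.All.Properties using (tabulate⁺)
open import Data.List.Relation.Unary.AllPairs using (_∷_)
open import Data.List.Relation.Unary.Any as Any using (index)
open import Data.List.Relation.Unary.Unique.Propositional using (Unique)
open import Data.List.Relation.Unary.Unique.Propositional.Properties using (allFin⁺; filter⁺)
open import Data.Nat using (ℕ; zero; suc; _+_; _*_; _∸_; _≤_; _<_; s≤s; z≤n; s≤s⁻¹; _≤?_; _<?_)
open import Data.Nat.Properties
  using (+-*-semiring; +-commutativeSemigroup; module ≤-Reasoning;
         +-assoc; +-comm; +-identityʳ; *-comm; *-identityʳ; *-zeroʳ; suc-injective;
         +-cancelˡ-≡; +-cancelʳ-≡; +-cancelʳ-≤; +-cancelʳ-<;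
         +-mono-≤; +-monoʳ-≤; +-monoˡ-<; *-monoʳ-≤;
         ≤-reflexive; ≤-trans; ≤-<-trans; ≤-pred; <-irrefl; <-cmp; <⇒≤; <⇒≱; ≮⇒≥; ≰⇒>;
         n≤0⇒n≡0; m≤m+n; m≤n+m; m<m+n; m∸n≤m; m∸n+n≡m; m+[n∸m]≡n; m+n∸n≡m; m<n⇒0<n∸m; ∸-monoʳ-≤)
open import Data.Nat.Tactic.RingSolver using (solve-∀)
open import Algebra.Properties.Semiring.Sum +-*-semiring
  using (sum; sum-syntax; ∑-comm; *-distribˡ-sum; sum-cong-≗)
open import Algebra.Properties.CommutativeSemigroup +-commutativeSemigroup
  using (xy∙z≈xz∙y; interchange)
open import Data.Product using (Σ; ∃; _×_; _,_; proj₁; proj₂; uncurry)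
open import Data.Sum using (_⊎_; inj₁; inj₂; map₂; swap)
open import Data.Sum.Function.Propositional using (_⊎-↔_)
open import Data.Sum.Properties using (inj₁-injective; inj₂-injective)
open import Function using (_∘_; _↔_; Inverse; Injective)
open import Function.Bundles using (Equivalence; mk⇔)
open import Function.Construct.Composition using (_↔-∘_)
open import Relation.Binary using (tri<; tri≈; tri>)
open import Relation.Binary.PropositionalEquality
open import Relation.Nullary using (Dec; yes; no; does; ¬_; contradiction)
open import Relation.Nullary.Decidable using (_×-dec_; _→-dec_; dec-true)
open import Relation.Unary using (Pred; Decidable)

-- Counting over finite index sets

𝟙 : Bool → ℕ
𝟙 true  = 1
𝟙 false = 0

𝟙-∧ : ∀ a b → 𝟙 (a ∧ b) ≡ 𝟙 a * 𝟙 b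
𝟙-∧ true  b = sym (+-identityʳ (𝟙 b))
𝟙-∧ false b = refl

sum-mono-≤ : ∀ {N} {f g : Fin N → ℕ} → (∀ i → f i ≤ g i) → sum f ≤ sum g
sum-mono-≤ {zero}  f≤g = z≤n
sum-mono-≤ {suc N} f≤g = +-mono-≤ (f≤g zero) (sum-mono-≤ (λ i → f≤g (suc i)))

term≤sum : ∀ {N} (f : Fin N → ℕ) i → f i ≤ sum f
term≤sum f zero    = m≤m+n _ _
term≤sum f (suc i) = ≤-trans (term≤sum (λ j → f (suc j)) i) (m≤n+m _ (f zero))

module _ {a p} {A : Set a} {P : Pred A p} (P? : Decidable P) where

  length-filter-tabulate : ∀ {N} (g : Fin N → A) →
    length (filter P? (tabulate g)) ≡ ∑[ i < N ] 𝟙 (does (P? (g i)))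
  length-filter-tabulate {zero}  g = refl
  length-filter-tabulate {suc N} g with does (P? (g zero))
  ... | true  = cong suc (length-filter-tabulate (λ i → g (suc i)))
  ... | false = length-filter-tabulate (λ i → g (suc i))

Unique⇒lookup-injective : ∀ {a} {A : Set a} {xs : List A} → Unique xs →
  ∀ i j → lookup xs i ≡ lookup xs j → i ≡ j
Unique⇒lookup-injective (_ ∷ _)       zero    zero    _  = refl
Unique⇒lookup-injective (x∉xs ∷ _)    zero    (suc j) eq = ⊥-elim (All.lookup x∉xs (∈-lookup j) eq)
Unique⇒lookup-injective (x∉xs ∷ _)    (suc i) zero    eq = ⊥-elim (All.lookup x∉xs (∈-lookup i) (sym eq))
Unique⇒lookup-injective (_ ∷ unique)  (suc i) (suc j) eq = cong suc (Unique⇒lookup-injective unique i j eq)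

length-filter-allFin≤ : ∀ {m d p} {P : Pred (Fin m) p} (P? : Decidable P)
  (g : ∀ e → P e → Fin d) → (∀ {e e′} p p′ → g e p ≡ g e′ p′ → e ≡ e′) →
  length (filter P? (allFin m)) ≤ d
length-filter-allFin≤ {m} {d} P? g g-injective = injective⇒≤ ĝ-injective
  where
  L : List (Fin m)
  L = filter P? (allFin m)
  ĝ : Fin (length L) → Fin d
  ĝ j = g (lookup L j) (proj₂ (∈-filter⁻ P? {xs = allFin m} (∈-lookup j)))
  ĝ-injective : ∀ {i j} → ĝ i ≡ ĝ j → i ≡ j
  ĝ-injective eq = Unique⇒lookup-injective (filter⁺ P? (allFin⁺ m)) _ _ (g-injective _ _ eq)

infix 4 _∈?_
_∈?_ : ∀ {N} (x : Fin N) (L : List (Fin N)) → Dec (x ∈ L)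
x ∈? L = Any.any? (x ≟_) L

∑-∈≤length : ∀ {N} (L : List (Fin N)) → ∑[ v < N ] 𝟙 (does (v ∈? L)) ≤ length L
∑-∈≤length {N} L = begin
  ∑[ v < N ] 𝟙 (does (v ∈? L))    ≡⟨ length-filter-tabulate (_∈? L) (λ v → v) ⟨
  length (filter (_∈? L) (allFin N)) ≤⟨ length-filter-allFin≤ (_∈? L) (λ _ → index) (index-injective (setoid _)) ⟩
  length L                          ∎
  where open ≤-Reasoning

∃∉ : ∀ {C} (L : List (Fin C)) → length L < C → ∃ λ x → x ∉ L
∃∉ {C} L len<C with all? (_∈? L)
... | yes all∈ = contradiction (injective⇒≤ (index-injective (setoid _) (all∈ _) (all∈ _))) (<⇒≱ len<C)
... | no ¬all∈ = ¬∀⟶∃¬ C _ (_∈? L) ¬all∈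

-- Digraphs of bounded out-degree

module OutdegreeColouring {N d C : ℕ} (out : Fin N → List (Fin N))
  (out≤d : ∀ v → length (out v) ≤ d) (d+d<C : d + d < C) where

  ProperOn : Subset N → (Fin N → Fin C) → Set
  ProperOn A c = ∀ {u w} → u ∈ₛ A → w ∈ₛ A → w ∈ out u → u ≢ w → c u ≢ c w

  inNeighbours : Subset N → Fin N → List (Fin N)
  inNeighbours A v = filter (λ u → u ∈ₛ? A ×-dec v ∈? out u) (allFin N)

  indegree : Subset N → Fin N → ℕ
  indegree A v = length (inNeighbours A v)

  count : Subset N → ℕ
  count A = ∑[ u < N ] 𝟙 (does (u ∈ₛ? A))

  -- Double counting: each arc inside A is charged to its tail, which has at most d out-neighbours.
  ∑-indegree≤ : ∀ A → ∑[ v < N ] indegree A v ≤ d * count A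
  ∑-indegree≤ A = begin
    ∑[ v < N ] indegree A v
      ≡⟨ sum-cong-≗ {N} (λ v → length-filter-tabulate (λ u → u ∈ₛ? A ×-dec v ∈? out u) (λ u → u)) ⟩
    ∑[ v < N ] ∑[ u < N ] 𝟙 (a u ∧ μ u v)
      ≡⟨ sum-cong-≗ (λ v → sum-cong-≗ (λ u → 𝟙-∧ (a u) (μ u v))) ⟩
    ∑[ v < N ] ∑[ u < N ] (𝟙 (a u) * 𝟙 (μ u v))
      ≡⟨ ∑-comm (λ v u → 𝟙 (a u) * 𝟙 (μ u v)) ⟩
    ∑[ u < N ] ∑[ v < N ] (𝟙 (a u) * 𝟙 (μ u v))
      ≡⟨ sum-cong-≗ (λ u → *-distribˡ-sum (𝟙 (a u)) (λ v → 𝟙 (μ u v))) ⟨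
    ∑[ u < N ] (𝟙 (a u) * ∑[ v < N ] 𝟙 (μ u v))
      ≤⟨ sum-mono-≤ (λ u → *-monoʳ-≤ (𝟙 (a u)) (≤-trans (∑-∈≤length (out u)) (out≤d u))) ⟩
    ∑[ u < N ] (𝟙 (a u) * d)
      ≡⟨ sum-cong-≗ (λ u → *-comm (𝟙 (a u)) d) ⟩
    ∑[ u < N ] (d * 𝟙 (a u))
      ≡⟨ *-distribˡ-sum d (λ u → 𝟙 (a u)) ⟨
    d * count A
      ∎
    where
    open ≤-Reasoning
    a : Fin N → Bool
    a u = does (u ∈ₛ? A)
    μ : Fin N → Fin N → Bool
    μ u v = does (v ∈? out u)

  empty-or-low-indegree : ∀ A → (∀ u → u ∉ₛ A) ⊎ (∃ λ v → v ∈ₛ A × indegree A v ≤ d)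
  empty-or-low-indegree A with all? (λ v → v ∈ₛ? A →-dec d <? indegree A v)
  ... | no ¬all-high = inj₂ (low (¬∀⟶∃¬ N _ (λ v → v ∈ₛ? A →-dec d <? indegree A v) ¬all-high))
    where
    low : (∃ λ v → ¬ (v ∈ₛ A → d < indegree A v)) → ∃ λ v → v ∈ₛ A × indegree A v ≤ d
    low (v , ¬high) with v ∈ₛ? A
    ... | yes v∈A = v , v∈A , ≮⇒≥ (λ high → ¬high (λ _ → high))
    ... | no v∉A  = contradiction (λ v∈A → contradiction v∈A v∉A) ¬high
  ... | yes all-high = inj₁ λ u u∈A → <-irrefl refl (≤-trans (count≥1 u u∈A) (≤-reflexive count≡0))
    where
    weighted : ∀ v → suc d * 𝟙 (does (v ∈ₛ? A)) ≤ indegree A v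
    weighted v with v ∈ₛ? A
    ... | yes v∈A = ≤-trans (≤-reflexive (*-identityʳ (suc d))) (all-high v v∈A)
    ... | no  _   = ≤-trans (≤-reflexive (*-zeroʳ (suc d))) z≤n
    count≤d*count : count A + d * count A ≤ d * count A
    count≤d*count = begin
      suc d * count A                            ≡⟨ *-distribˡ-sum (suc d) (λ v → 𝟙 (does (v ∈ₛ? A))) ⟩
      ∑[ v < N ] (suc d * 𝟙 (does (v ∈ₛ? A)))   ≤⟨ sum-mono-≤ weighted ⟩
      ∑[ v < N ] indegree A v                   ≤⟨ ∑-indegree≤ A ⟩
      d * count A                                ∎
      where open ≤-Reasoning
    count≡0 : count A ≡ 0
    count≡0 = n≤0⇒n≡0 (+-cancelʳ-≤ (d * count A) (count A) 0 count≤d*count)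
    count≥1 : ∀ u → u ∈ₛ A → 1 ≤ count A
    count≥1 u u∈A = subst (λ b → 𝟙 b ≤ count A) (dec-true (u ∈ₛ? A) u∈A) (term≤sum _ u)

  recolour : (Fin N → Fin C) → Fin N → Fin C → Fin N → Fin C
  recolour c v x u with u ≟ v
  ... | yes _ = x
  ... | no  _ = c u

  extend : ∀ A v → v ∈ₛ A → indegree A v ≤ d →
           Σ (Fin N → Fin C) (ProperOn (A - v)) → Σ (Fin N → Fin C) (ProperOn A)
  extend A v v∈A low (c , c-proper) = recolour c v x , proper
    where
    forbidden : List (Fin C)
    forbidden = map c (out v) ++ map c (inNeighbours A v)
    forbidden<C : length forbidden < C
    forbidden<C = begin-strict
      length forbidden                                  ≡⟨ length-++ (map c (out v)) ⟩
      length (map c (out v)) + length (map c (inNeighbours A v))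
                                                        ≡⟨ cong₂ _+_ (length-map c (out v)) (length-map c (inNeighbours A v)) ⟩
      length (out v) + indegree A v                     ≤⟨ +-mono-≤ (out≤d v) low ⟩
      d + d                                             <⟨ d+d<C ⟩
      C                                                 ∎
      where open ≤-Reasoning
    x : Fin C
    x = proj₁ (∃∉ forbidden forbidden<C)
    x∉forbidden : x ∉ forbidden
    x∉forbidden = proj₂ (∃∉ forbidden forbidden<C)
    ∈A-v : ∀ {u} → u ∈ₛ A → u ≢ v → u ∈ₛ A - v
    ∈A-v u∈A u≢v = x∈p∧x∉q⇒x∈p─q u∈A (u≢v ∘ x∈⁅y⁆⇒x≡y _)
    proper : ProperOn A (recolour c v x)
    proper {u} {w} u∈A w∈A w∈out u≢w with u ≟ v | w ≟ v
    ... | yes refl | yes refl = contradiction refl u≢w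
    ... | yes refl | no  _    = λ x≡cw → x∉forbidden (subst (_∈ forbidden) (sym x≡cw)
                                   (∈-++⁺ˡ (∈-map⁺ c w∈out)))
    ... | no  _    | yes refl = λ cu≡x → x∉forbidden (subst (_∈ forbidden) cu≡x
                                   (∈-++⁺ʳ (map c (out v)) (∈-map⁺ c (∈-filter⁺ _ (∈-allFin u) (u∈A , w∈out)))))
    ... | no u≢v   | no w≢v   = c-proper (∈A-v u∈A u≢v) (∈A-v w∈A w≢v) w∈out u≢w

  colourOn : ∀ s A → ∣ A ∣ ≤ s → Σ (Fin N → Fin C) (ProperOn A)
  colourOn s A _ with empty-or-low-indegree A
  ... | inj₁ A-empty = (λ _ → fromℕ< (≤-trans (s≤s z≤n) d+d<C)) , λ u∈A → contradiction u∈A (A-empty _)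
  colourOn zero    A ∣A∣≤0 | inj₂ (v , v∈A , _) = contradiction (≤-trans (x∈p⇒∣p-x∣<∣p∣ v∈A) ∣A∣≤0) λ ()
  colourOn (suc s) A ∣A∣≤s | inj₂ (v , v∈A , low) =
    extend A v v∈A low (colourOn s (A - v) (≤-pred (≤-trans (x∈p⇒∣p-x∣<∣p∣ v∈A) ∣A∣≤s)))

  colouring : Σ (Fin N → Fin C) λ c → ∀ {u w} → w ∈ out u → u ≢ w → c u ≢ c w
  colouring with colourOn N ⊤ (∣p∣≤n ⊤)
  ... | c , c-proper = c , c-proper ∈⊤ ∈⊤

-- Colouring a hypergraph from an orientation

other : ∀ {r} → Fin r → Fin r
other {suc (suc _)} zero    = suc zero
other {suc (suc _)} (suc _) = zero
other {suc zero}    i       = i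

other≢ : ∀ {r} → 2 ≤ r → (i : Fin r) → other i ≢ i
other≢ {suc (suc _)} _ zero    ()
other≢ {suc (suc _)} _ (suc _) ()
other≢ {suc zero}    (s≤s ()) _

<⇒≤∸1 : ∀ {m k} → m < k → m ≤ k ∸ 1
<⇒≤∸1 {k = suc _} = s≤s⁻¹

d+d<r*d+1 : ∀ {r} d → 2 ≤ r → d + d < r * d + 1
d+d<r*d+1 {suc (suc r)} d _ = begin-strict
  d + d               ≤⟨ +-monoʳ-≤ d (m≤m+n d (r * d)) ⟩
  d + (d + r * d)     <⟨ m<m+n _ (s≤s z≤n) ⟩
  d + (d + r * d) + 1 ∎
  where open ≤-Reasoning
d+d<r*d+1 {suc zero} _ (s≤s ())

code : ∀ {f r C} → Fin f ⊎ (Fin r × Fin C) → Fin (f + r * C)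
code {f} {r} {C} = join f (r * C) ∘ map₂ (uncurry combine)

code-injective : ∀ {f r C} → Injective _≡_ _≡_ (code {f} {r} {C})
code-injective {f} {r} {C} {κ} {κ′} eq =
  trans (sym (decode∘code κ)) (trans (cong decode eq) (decode∘code κ′))
  where
  decode : Fin (f + r * C) → Fin f ⊎ (Fin r × Fin C)
  decode = map₂ (remQuot C) ∘ splitAt f
  decode∘code : ∀ κ → decode (code κ) ≡ κ
  decode∘code (inj₁ ρ)       = cong (map₂ (remQuot C)) (splitAt-join f (r * C) (inj₁ ρ))
  decode∘code (inj₂ (i , x)) = trans (cong (map₂ (remQuot C)) (splitAt-join f (r * C) (inj₂ (combine i x))))
                                     (cong inj₂ (remQuot-combine i x))

module OrientationColouring {r n} (H : Hypergraph r n) (D : Orientation H) (k : ℕ) where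

  Rich : Fin n → Set
  Rich v = ∀ i → k ≤ deg D i v

  rank : ∀ {v} → Rich v → Fin (countRich D k)
  rank {v} rich = index (∈-filter⁺ (λ u → all? (λ i → k ≤? deg D i u)) (∈-allFin v) rich)

  rank-injective : ∀ {u w} (ρ : Rich u) (σ : Rich w) → rank ρ ≡ rank σ → u ≡ w
  rank-injective ρ σ = index-injective (setoid _) _ _

  classify : ∀ v → Rich v ⊎ ∃ λ i → deg D i v < k
  classify v with all? (λ i → k ≤? deg D i v)
  ... | yes rich = inj₁ rich
  ... | no ¬rich with ¬∀⟶∃¬ r _ (λ i → k ≤? deg D i v) ¬rich
  ...   | i , k≰deg = inj₂ (i , ≰⇒> k≰deg)

  neighboursAt : Fin r → Fin n → List (Fin n)
  neighboursAt i v = map (λ e → pos D e (other i)) (filter (λ e → pos D e i ≟ v) (allFin (m H)))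

  outOf : ∀ v → Rich v ⊎ ∃ (λ i → deg D i v < k) → List (Fin n)
  outOf v (inj₁ _)       = []
  outOf v (inj₂ (i , _)) = neighboursAt i v

  out : Fin n → List (Fin n)
  out v = outOf v (classify v)

  out≤ : ∀ v → length (out v) ≤ k ∸ 1
  out≤ v with classify v
  ... | inj₁ _          = z≤n
  ... | inj₂ (i , deg<k) = ≤-trans (≤-reflexive (length-map _ (filter _ (allFin (m H))))) (<⇒≤∸1 deg<k)

  module _ {C} (c : Fin n → Fin C) where

    kindOf : ∀ v → Rich v ⊎ ∃ (λ i → deg D i v < k) → Fin (countRich D k) ⊎ (Fin r × Fin C)
    kindOf v (inj₁ rich)    = inj₁ (rank rich)
    kindOf v (inj₂ (i , _)) = inj₂ (i , c v)

    colour : Fin n → Fin (countRich D k + r * C)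
    colour v = code (kindOf v (classify v))

    kindOf-rich : ∀ {v} cl ρ′ → kindOf v cl ≡ inj₁ ρ′ → Σ (Rich v) λ ρ → rank ρ ≡ ρ′
    kindOf-rich (inj₁ ρ) _ refl = ρ , refl

    kindOf-poor : ∀ {v} cl {i x} → kindOf v cl ≡ inj₂ (i , x) →
                  c v ≡ x × (∀ e → pos D e i ≡ v → pos D e (other i) ∈ outOf v cl)
    kindOf-poor (inj₂ (i , _)) refl =
      refl , λ e at-i≡v → ∈-map⁺ (λ e → pos D e (other i)) (∈-filter⁺ (λ e → pos D e i ≟ _) (∈-allFin e) at-i≡v)

    colour-proper : 2 ≤ r → (∀ {u w} → w ∈ out u → u ≢ w → c u ≢ c w) → ProperColouring H colour
    colour-proper 2≤r c-proper e mono = separate (kind (at a)) refl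
      where
      at : Fin r → Fin n
      at = pos D e
      kind : Fin n → Fin (countRich D k) ⊎ (Fin r × Fin C)
      kind v = kindOf v (classify v)
      a : Fin r
      a = fromℕ< (≤-trans (s≤s z≤n) 2≤r)
      at∈e : ∀ j → at j ∈ₛ edge H e
      at∈e j = Equivalence.from (pos-onto D e (at j)) (j , refl)
      same-kind : ∀ j j′ → kind (at j) ≡ kind (at j′)
      same-kind j j′ = code-injective (mono _ _ (at∈e j) (at∈e j′))
      at-other≢ : ∀ j → at j ≢ at (other j)
      at-other≢ j eq = other≢ 2≤r j (sym (pos-inj D e eq))
      separate : ∀ κ → kind (at a) ≡ κ → ⊥
      separate (inj₁ ρ′) eq
        with kindOf-rich (classify (at a)) ρ′ eq
           | kindOf-rich (classify (at (other a))) ρ′ (trans (same-kind (other a) a) eq)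
      ... | ρ , ρ≡ | σ , σ≡ = at-other≢ a (rank-injective ρ σ (trans ρ≡ (sym σ≡)))
      separate (inj₂ (i , x)) eq
        with kindOf-poor (classify (at i)) (trans (same-kind i a) eq)
           | kindOf-poor (classify (at (other i))) (trans (same-kind (other i) a) eq)
      ... | cu≡x , out∋ | cw≡x , _ = c-proper (out∋ e refl) (at-other≢ i) (trans cu≡x (sym cw≡x))

positions-equal : ∀ {r} → ¬ 2 ≤ r → (i j : Fin r) → i ≡ j
positions-equal {suc zero}    _   zero zero = refl
positions-equal {suc (suc _)} r<2 _    _    = ⊥-elim (r<2 (s≤s (s≤s z≤n)))

edgeless : ∀ {r n c} {H : Hypergraph r n} → Orientation H → ¬ 2 ≤ r →
           {col : Fin n → Fin c} → ProperColouring H col → Fin (m H) → ⊥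
edgeless {H = H} D r<2 {col} proper e = proper e mono
  where
  mono : Monochromatic H col e
  mono u w u∈e w∈e with Equivalence.to (pos-onto D e u) u∈e | Equivalence.to (pos-onto D e w) w∈e
  ... | i , refl | j , refl = cong (col ∘ pos D e) (positions-equal r<2 i j)

orientation-colourable : ∀ {r n} (H : Hypergraph r n) (D : Orientation H) k →
  2 ≤ r ⊎ (Fin (m H) → ⊥) → Colourable H (countRich D k + r * (r * (k ∸ 1) + 1))
orientation-colourable {r} H D k (inj₁ 2≤r) =
  colour (proj₁ colouring) , colour-proper (proj₁ colouring) 2≤r (proj₂ colouring)
  where
  open OrientationColouring H D k
  open OutdegreeColouring out out≤ (d+d<r*d+1 (k ∸ 1) 2≤r)
orientation-colourable {r} H D k (inj₂ no-edges) =
  colour (λ _ → fromℕ< (m≤n+m 1 (r * (k ∸ 1)))) , λ e → ⊥-elim (no-edges e)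
  where open OrientationColouring H D k

-- The bound does not need 1 ≤ k.
chromatic-bound : (r n k : ℕ) (H : Hypergraph r n) → 1 ≤ k → (χ f : ℕ) →
  IsChromaticNumber H χ → IsF1 H k f → χ ≤ f + r * (r * (k ∸ 1) + 1)
chromatic-bound r n k H _ χ f ((_ , proper) , minimal) ((D , rich≡f) , _) =
  minimal _ (subst (λ f → Colourable H (f + r * (r * (k ∸ 1) + 1))) rich≡f
                   (orientation-colourable H D k two-or-edgeless))
  where
  two-or-edgeless : 2 ≤ r ⊎ (Fin (m H) → ⊥)
  two-or-edgeless with 2 ≤? r
  ... | yes 2≤r = inj₁ 2≤r
  ... | no  r<2 = inj₂ (edgeless D r<2 proper)

-- Steps on the cycle ℤ/M

module CyclicSteps (d : ℕ) where

  M : ℕ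
  M = suc (d + d)

  -- For representatives a b < M: b is s steps after a on the cycle ℤ/M.
  _⟶[_]_ : ℕ → ℕ → ℕ → Set
  a ⟶[ s ] b = a + s ≡ b ⊎ a + s ≡ b + M

  step-back : ∀ {b s} → b < M → s ≤ M → ∃ λ a → a < M × a ⟶[ s ] b
  step-back {b} {s} b<M s≤M with s ≤? b
  ... | yes s≤b = b ∸ s , ≤-<-trans (m∸n≤m b s) b<M , inj₁ (m∸n+n≡m s≤b)
  ... | no  s≰b = b + M ∸ s , a<M , inj₂ (m∸n+n≡m s≤b+M)
    where
    s≤b+M : s ≤ b + M
    s≤b+M = ≤-trans s≤M (m≤n+m M b)
    a<M : b + M ∸ s < M
    a<M = +-cancelʳ-< s (b + M ∸ s) M (begin-strict
      b + M ∸ s + s ≡⟨ m∸n+n≡m s≤b+M ⟩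
      b + M         <⟨ +-monoˡ-< M (≰⇒> s≰b) ⟩
      s + M         ≡⟨ +-comm s M ⟩
      M + s         ∎)
      where open ≤-Reasoning

  ⟶-injectiveˡ : ∀ {a a′ s b} → a < M → a′ < M → a ⟶[ s ] b → a′ ⟶[ s ] b → a ≡ a′
  ⟶-injectiveˡ {s = s} _ _ (inj₁ p) (inj₁ q) = +-cancelʳ-≡ s _ _ (trans p (sym q))
  ⟶-injectiveˡ {s = s} _ _ (inj₂ p) (inj₂ q) = +-cancelʳ-≡ s _ _ (trans p (sym q))
  ⟶-injectiveˡ {a} {a′} {s} _ a′<M (inj₁ p) (inj₂ q) =
    contradiction (subst (M ≤_) (sym a′≡a+M) (m≤n+m M a)) (<⇒≱ a′<M)
    where
    a′≡a+M : a′ ≡ a + M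
    a′≡a+M = +-cancelʳ-≡ s a′ (a + M) (trans q (trans (cong (_+ M) (sym p)) (xy∙z≈xz∙y a s M)))
  ⟶-injectiveˡ a<M a′<M (inj₂ p) (inj₁ q) = sym (⟶-injectiveˡ a′<M a<M (inj₁ q) (inj₂ p))

  ⟶-injectiveʳ : ∀ {a s s′ b} → s < M → s′ < M → a ⟶[ s ] b → a ⟶[ s′ ] b → s ≡ s′
  ⟶-injectiveʳ {a} _ _ (inj₁ p) (inj₁ q) = +-cancelˡ-≡ a _ _ (trans p (sym q))
  ⟶-injectiveʳ {a} _ _ (inj₂ p) (inj₂ q) = +-cancelˡ-≡ a _ _ (trans p (sym q))
  ⟶-injectiveʳ {a} {s} {s′} _ s′<M (inj₁ p) (inj₂ q) =
    contradiction (subst (M ≤_) (sym s′≡s+M) (m≤n+m M s)) (<⇒≱ s′<M)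
    where
    s′≡s+M : s′ ≡ s + M
    s′≡s+M = +-cancelˡ-≡ a s′ (s + M) (trans q (trans (cong (_+ M) (sym p)) (+-assoc a s M)))
  ⟶-injectiveʳ s<M s′<M (inj₂ p) (inj₁ q) = sym (⟶-injectiveʳ s′<M s<M (inj₁ q) (inj₂ p))

  ⟶-irrefl : ∀ {a s} → 0 < s → s < M → ¬ a ⟶[ s ] a
  ⟶-irrefl {a} {s} 0<s s<M a⟶a = <-irrefl (sym s≡0) 0<s
    where
    s≡0 : s ≡ 0
    s≡0 = ⟶-injectiveʳ s<M (s≤s z≤n) a⟶a (inj₁ (+-identityʳ a))

  -- Going around the cycle and back takes 0, M or M + M steps.
  ⟶-asym : ∀ {a b s s′} → 0 < s + s′ → s + s′ < M → a ⟶[ s ] b → b ⟶[ s′ ] a → ⊥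
  ⟶-asym {a} {b} {s} {s′} pos small = go
    where
    ≢M : s + s′ ≢ M
    ≢M eq = <-irrefl eq small
    go : a ⟶[ s ] b → b ⟶[ s′ ] a → _
    go (inj₁ p) (inj₁ q) = <-irrefl (sym (+-cancelˡ-≡ a (s + s′) 0
      (trans (sym (+-assoc a s s′)) (trans (cong (_+ s′) p) (trans q (sym (+-identityʳ a))))))) pos
    go (inj₁ p) (inj₂ q) = ≢M (+-cancelˡ-≡ a (s + s′) M
      (trans (sym (+-assoc a s s′)) (trans (cong (_+ s′) p) q)))
    go (inj₂ p) (inj₁ q) = ≢M (trans (+-comm s s′) (+-cancelˡ-≡ b (s′ + s) M
      (trans (sym (+-assoc b s′ s)) (trans (cong (_+ s) q) p))))
    go (inj₂ p) (inj₂ q) = <-irrefl (+-cancelˡ-≡ (a + b) (s + s′) (M + M) (begin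
      a + b + (s + s′) ≡⟨ interchange a b s s′ ⟩
      a + s + (b + s′) ≡⟨ cong₂ _+_ p q ⟩
      b + M + (a + M)  ≡⟨ interchange b M a M ⟩
      b + a + (M + M)  ≡⟨ cong (_+ (M + M)) (+-comm b a) ⟩
      a + b + (M + M)  ∎)) (≤-trans small (m≤m+n M M))
      where open ≡-Reasoning

  ⟶-total< : ∀ {a b} → a < b → b < M → ∃ λ s → 0 < s × s ≤ d × (a ⟶[ s ] b ⊎ b ⟶[ s ] a)
  ⟶-total< {a} {b} a<b b<M with b ∸ a ≤? d
  ... | yes δ≤d = b ∸ a , m<n⇒0<n∸m a<b , δ≤d , inj₁ (inj₁ (m+[n∸m]≡n (<⇒≤ a<b)))
  ... | no  δ≰d = M ∸ δ , m<n⇒0<n∸m δ<M , M∸δ≤d , inj₂ (inj₂ b+[M∸δ]≡a+M)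
    where
    δ = b ∸ a
    δ<M : δ < M
    δ<M = ≤-<-trans (m∸n≤m b a) b<M
    M∸δ≤d : M ∸ δ ≤ d
    M∸δ≤d = ≤-trans (∸-monoʳ-≤ M (≰⇒> δ≰d)) (≤-reflexive (m+n∸n≡m d d))
    b+[M∸δ]≡a+M : b + (M ∸ δ) ≡ a + M
    b+[M∸δ]≡a+M = begin
      b + (M ∸ δ)       ≡⟨ cong (_+ (M ∸ δ)) (m+[n∸m]≡n (<⇒≤ a<b)) ⟨
      a + δ + (M ∸ δ)   ≡⟨ +-assoc a δ (M ∸ δ) ⟩
      a + (δ + (M ∸ δ)) ≡⟨ cong (a +_) (m+[n∸m]≡n (<⇒≤ δ<M)) ⟩
      a + M             ∎
      where open ≡-Reasoning

  ⟶-total : ∀ {a b} → a < M → b < M → a ≢ b → ∃ λ s → 0 < s × s ≤ d × (a ⟶[ s ] b ⊎ b ⟶[ s ] a)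
  ⟶-total {a} {b} a<M b<M a≢b with <-cmp a b
  ... | tri< a<b _ _ = ⟶-total< a<b b<M
  ... | tri≈ _ a≡b _ = contradiction a≡b a≢b
  ... | tri> _ _ b<a with ⟶-total< b<a a<M
  ...   | s , 0<s , s≤d , dir = s , 0<s , s≤d , swap dir

  1+t<M : (t : Fin d) → suc (toℕ t) < M
  1+t<M t = s≤s (≤-trans (toℕ<n t) (m≤m+n d d))

  -- sub y t is the vertex t + 1 steps before y.
  sub : Fin M → Fin d → Fin M
  sub y t = fromℕ< (proj₁ (proj₂ (step-back (toℕ<n y) (<⇒≤ (1+t<M t)))))

  sub-step : ∀ y t → toℕ (sub y t) ⟶[ suc (toℕ t) ] toℕ y
  sub-step y t = subst (_⟶[ suc (toℕ t) ] toℕ y) (sym (toℕ-fromℕ< _))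
                       (proj₂ (proj₂ (step-back (toℕ<n y) (<⇒≤ (1+t<M t)))))

  sub≢ : ∀ y t → sub y t ≢ y
  sub≢ y t eq = ⟶-irrefl (s≤s z≤n) (1+t<M t) (subst (λ z → toℕ z ⟶[ _ ] toℕ y) eq (sub-step y t))

  sub-injective : ∀ y {t t′} → sub y t ≡ sub y t′ → t ≡ t′
  sub-injective y {t} {t′} eq = toℕ-injective (suc-injective
    (⟶-injectiveʳ (1+t<M t) (1+t<M t′) (sub-step y t) (subst (λ z → toℕ z ⟶[ _ ] toℕ y) (sym eq) (sub-step y t′))))

  sub-asym : ∀ {y y′} t t′ → sub y t ≡ y′ → sub y′ t′ ≡ y → ⊥
  sub-asym {y} {y′} t t′ p q = ⟶-asym (s≤s z≤n) (s≤s (+-mono-≤ (toℕ<n t) (toℕ<n t′)))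
    (subst (λ z → toℕ z ⟶[ _ ] toℕ y) p (sub-step y t))
    (subst (λ z → toℕ z ⟶[ _ ] toℕ y′) q (sub-step y′ t′))

  step⇒sub : ∀ {x y s} → 0 < s → s ≤ d → toℕ x ⟶[ s ] toℕ y → ∃ λ t → sub y t ≡ x
  step⇒sub {x} {y} {suc s} _ s<d x⟶y = t , toℕ-injective
    (⟶-injectiveˡ (toℕ<n (sub y t)) (toℕ<n x)
      (subst (λ z → toℕ (sub y t) ⟶[ suc z ] toℕ y) (toℕ-fromℕ< s<d) (sub-step y t)) x⟶y)
    where
    t : Fin d
    t = fromℕ< s<d

  sub-total : ∀ {x y} → x ≢ y → (∃ λ t → sub y t ≡ x) ⊎ (∃ λ t → sub x t ≡ y)
  sub-total {x} {y} x≢y with ⟶-total (toℕ<n x) (toℕ<n y) (x≢y ∘ toℕ-injective)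
  ... | s , 0<s , s≤d , inj₁ x⟶y = inj₁ (step⇒sub 0<s s≤d x⟶y)
  ... | s , 0<s , s≤d , inj₂ y⟶x = inj₂ (step⇒sub 0<s s≤d y⟶x)

-- Graphs given by a list of arcs

pair : ∀ {n} → Fin n → Fin n → Subset n
pair u w = ⁅ u ⁆ ∪ ⁅ w ⁆

∈-pairˡ : ∀ {n} (u w : Fin n) → u ∈ₛ pair u w
∈-pairˡ u w = x∈p∪q⁺ (inj₁ (x∈⁅x⁆ u))

∈-pairʳ : ∀ {n} (u w : Fin n) → w ∈ₛ pair u w
∈-pairʳ u w = x∈p∪q⁺ {p = ⁅ u ⁆} (inj₂ (x∈⁅x⁆ w))

∈-pair⁻ : ∀ {n} {x u w : Fin n} → x ∈ₛ pair u w → x ≡ u ⊎ x ≡ w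
∈-pair⁻ {u = u} {w} x∈ with x∈p∪q⁻ ⁅ u ⁆ ⁅ w ⁆ x∈
... | inj₁ x∈u = inj₁ (x∈⁅y⁆⇒x≡y u x∈u)
... | inj₂ x∈w = inj₂ (x∈⁅y⁆⇒x≡y w x∈w)

∣pair∣≡2 : ∀ {n} {u w : Fin n} → u ≢ w → ∣ pair u w ∣ ≡ 2
∣pair∣≡2 {u = zero}  {zero}  u≢w = contradiction refl u≢w
∣pair∣≡2 {u = zero}  {suc w} _   = cong suc (trans (cong ∣_∣ (∪-identityˡ ⁅ w ⁆)) (∣⁅x⁆∣≡1 w))
∣pair∣≡2 {u = suc u} {zero}  _   = cong suc (trans (cong ∣_∣ (∪-identityʳ ⁅ u ⁆)) (∣⁅x⁆∣≡1 u))
∣pair∣≡2 {u = suc u} {suc w} u≢w = ∣pair∣≡2 (u≢w ∘ cong suc)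

pair-injective : ∀ {n} {u w u′ w′ : Fin n} → u ≢ w → pair u w ≡ pair u′ w′ →
                 (u ≡ u′ × w ≡ w′) ⊎ (u ≡ w′ × w ≡ u′)
pair-injective {u = u} {w} u≢w eq
  with ∈-pair⁻ (subst (u ∈ₛ_) eq (∈-pairˡ u w)) | ∈-pair⁻ (subst (w ∈ₛ_) eq (∈-pairʳ u w))
... | inj₁ u≡u′ | inj₂ w≡w′ = inj₁ (u≡u′ , w≡w′)
... | inj₂ u≡w′ | inj₁ w≡u′ = inj₂ (u≡w′ , w≡u′)
... | inj₁ u≡u′ | inj₁ w≡u′ = contradiction (trans u≡u′ (sym w≡u′)) u≢w
... | inj₂ u≡w′ | inj₂ w≡w′ = contradiction (trans u≡w′ (sym w≡w′)) u≢w

module ArcGraph {a n} (tail head : Fin a → Fin n)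
  (loopless : ∀ e → tail e ≢ head e)
  (simple : ∀ {e e′} → tail e ≡ tail e′ → head e ≡ head e′ → e ≡ e′)
  (no-2-cycle : ∀ {e e′} → tail e ≡ head e′ → head e ≡ tail e′ → ⊥) where

  graph : Hypergraph 2 n
  graph = record
    { m        = a
    ; edge     = λ e → pair (tail e) (head e)
    ; distinct = edges-distinct
    ; uniform  = λ e → ∣pair∣≡2 (loopless e)
    }
    where
    edges-distinct : ∀ {e e′} → pair (tail e) (head e) ≡ pair (tail e′) (head e′) → e ≡ e′
    edges-distinct {e} eq with pair-injective (loopless e) eq
    ... | inj₁ (t≡t , h≡h) = simple t≡t h≡h
    ... | inj₂ (t≡h , h≡t) = ⊥-elim (no-2-cycle t≡h h≡t)

  endpoint : Fin a → Fin 2 → Fin n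
  endpoint e zero       = tail e
  endpoint e (suc zero) = head e

  orientation : Orientation graph
  orientation = record
    { pos      = endpoint
    ; pos-inj  = endpoint-injective
    ; pos-onto = λ e v → mk⇔ (to e) (from e)
    }
    where
    endpoint-injective : ∀ e {i j} → endpoint e i ≡ endpoint e j → i ≡ j
    endpoint-injective e {zero}     {zero}     _  = refl
    endpoint-injective e {zero}     {suc zero} eq = contradiction eq (loopless e)
    endpoint-injective e {suc zero} {zero}     eq = contradiction (sym eq) (loopless e)
    endpoint-injective e {suc zero} {suc zero} _  = refl
    to : ∀ e {v} → v ∈ₛ pair (tail e) (head e) → ∃ λ i → endpoint e i ≡ v
    to e v∈ with ∈-pair⁻ v∈
    ... | inj₁ v≡t = zero , sym v≡t
    ... | inj₂ v≡h = suc zero , sym v≡h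
    from : ∀ e {v} → (∃ λ i → endpoint e i ≡ v) → v ∈ₛ pair (tail e) (head e)
    from e (zero     , refl) = ∈-pairˡ _ _
    from e (suc zero , refl) = ∈-pairʳ _ _

  Joins : Fin a → Fin n → Fin n → Set
  Joins e u w = (tail e ≡ u × head e ≡ w) ⊎ (tail e ≡ w × head e ≡ u)

  monochromatic : ∀ {c} (col : Fin n → Fin c) e → col (tail e) ≡ col (head e) → Monochromatic graph col e
  monochromatic col e same u w u∈ w∈ with ∈-pair⁻ u∈ | ∈-pair⁻ w∈
  ... | inj₁ refl | inj₁ refl = refl
  ... | inj₁ refl | inj₂ refl = same
  ... | inj₂ refl | inj₁ refl = sym same
  ... | inj₂ refl | inj₂ refl = refl

  complete⇒chromatic : (∀ {u w} → u ≢ w → ∃ λ e → Joins e u w) → IsChromaticNumber graph n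
  complete⇒chromatic joined = ((λ v → v) , id-proper) , n≤colours
    where
    id-proper : ProperColouring graph (λ v → v)
    id-proper e mono = loopless e (mono _ _ (∈-pairˡ _ _) (∈-pairʳ _ _))
    n≤colours : ∀ c → Colourable graph c → n ≤ c
    n≤colours c (col , proper) with n ≤? c
    ... | yes n≤c = n≤c
    ... | no  n≰c with pigeonhole (≰⇒> n≰c) col
    ...   | i , j , i<j , coli≡colj with joined (<⇒≢ i<j)
    ...     | e , inj₁ (refl , refl) = ⊥-elim (proper e (monochromatic col e coli≡colj))
    ...     | e , inj₂ (refl , refl) = ⊥-elim (proper e (monochromatic col e (sym coli≡colj)))

-- The extremal graphs

module SharpExample (d : ℕ) where
  open CyclicSteps d

  Side : Set
  Side = Fin M ⊎ Fin M

  pattern A x = inj₁ x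
  pattern B y = inj₂ y

  -- Every arc from side A to side B, and inside each side the rotational tournament
  -- on ℤ/M, whose arc (y , t) runs from y − (t + 1) to y.
  Arc : Set
  Arc = (Fin M × Fin M) ⊎ ((Fin M × Fin d) ⊎ (Fin M × Fin d))

  pattern across x y  = inj₁ (x , y)
  pattern withinA y t = inj₂ (inj₁ (y , t))
  pattern withinB y t = inj₂ (inj₂ (y , t))

  tail′ head′ : Arc → Side
  tail′ (across x _)  = A x
  tail′ (withinA y t) = A (sub y t)
  tail′ (withinB y _) = B y
  head′ (across _ y)  = B y
  head′ (withinA y _) = A y
  head′ (withinB y t) = B (sub y t)

  tail′≢head′ : ∀ α → tail′ α ≢ head′ α
  tail′≢head′ (across _ _)  ()
  tail′≢head′ (withinA y t) eq = sub≢ y t (inj₁-injective eq)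
  tail′≢head′ (withinB y t) eq = sub≢ y t (sym (inj₂-injective eq))

  arc-simple : ∀ {α β} → tail′ α ≡ tail′ β → head′ α ≡ head′ β → α ≡ β
  arc-simple {across _ _}  {across _ _}  refl refl = refl
  arc-simple {withinA y t} {withinA _ _} eq   refl = cong (withinA y) (sub-injective y (inj₁-injective eq))
  arc-simple {withinB y t} {withinB _ _} refl eq   = cong (withinB y) (sub-injective y (inj₂-injective eq))
  arc-simple {across _ _}  {withinA _ _} _    ()
  arc-simple {across _ _}  {withinB _ _} ()   _
  arc-simple {withinA _ _} {across _ _}  _    ()
  arc-simple {withinA _ _} {withinB _ _} ()   _
  arc-simple {withinB _ _} {across _ _}  ()   _
  arc-simple {withinB _ _} {withinA _ _} ()   _

  arc-no-2-cycle : ∀ {α β} → tail′ α ≡ head′ β → head′ α ≡ tail′ β → ⊥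
  arc-no-2-cycle {withinA y t} {withinA y′ t′} p q = sub-asym t t′ (inj₁-injective p) (sym (inj₁-injective q))
  arc-no-2-cycle {withinB y t} {withinB y′ t′} p q = sub-asym t t′ (inj₂-injective q) (sym (inj₂-injective p))
  arc-no-2-cycle {across _ _}  {across _ _}  () _
  arc-no-2-cycle {across _ _}  {withinA _ _} _  ()
  arc-no-2-cycle {across _ _}  {withinB _ _} () _
  arc-no-2-cycle {withinA _ _} {across _ _}  () _
  arc-no-2-cycle {withinA _ _} {withinB _ _} () _
  arc-no-2-cycle {withinB _ _} {across _ _}  _  ()
  arc-no-2-cycle {withinB _ _} {withinA _ _} () _

  arc-cover : ∀ {u w} → u ≢ w → ∃ λ α → (tail′ α ≡ u × head′ α ≡ w) ⊎ (tail′ α ≡ w × head′ α ≡ u)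
  arc-cover {A x} {B y} _ = across x y , inj₁ (refl , refl)
  arc-cover {B y} {A x} _ = across x y , inj₂ (refl , refl)
  arc-cover {A x} {A y} x≢y with sub-total (x≢y ∘ cong A)
  ... | inj₁ (t , refl) = withinA y t , inj₁ (refl , refl)
  ... | inj₂ (t , refl) = withinA x t , inj₂ (refl , refl)
  arc-cover {B x} {B y} x≢y with sub-total (x≢y ∘ cong B)
  ... | inj₁ (t , refl) = withinB y t , inj₂ (refl , refl)
  ... | inj₂ (t , refl) = withinB x t , inj₁ (refl , refl)

  inA-index : ∀ {y} α → head′ α ≡ A y → Fin d
  inA-index (withinA _ t) _ = t

  inA-index-injective : ∀ {y} α β (p : head′ α ≡ A y) (q : head′ β ≡ A y) → inA-index α p ≡ inA-index β q → α ≡ β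
  inA-index-injective (withinA _ _) (withinA _ _) refl refl refl = refl

  outB-index : ∀ {y} α → tail′ α ≡ B y → Fin d
  outB-index (withinB _ t) _ = t

  outB-index-injective : ∀ {y} α β (p : tail′ α ≡ B y) (q : tail′ β ≡ B y) → outB-index α p ≡ outB-index β q → α ≡ β
  outB-index-injective (withinB _ _) (withinB _ _) refl refl refl = refl

  arcIndex : Fin (M * M + (M * d + M * d)) ↔ Arc
  arcIndex = (*↔× ⊎-↔ ((*↔× ⊎-↔ *↔×) ↔-∘ +↔⊎)) ↔-∘ +↔⊎

  arc : Fin (M * M + (M * d + M * d)) → Arc
  arc = Inverse.to arcIndex

  arc-injective : ∀ {e e′} → arc e ≡ arc e′ → e ≡ e′
  arc-injective {e} {e′} eq = trans (sym (Inverse.strictlyInverseʳ arcIndex e))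
    (trans (cong (Inverse.from arcIndex) eq) (Inverse.strictlyInverseʳ arcIndex e′))

  vertex : Side → Fin (M + M)
  vertex = join M M

  vertex-injective : ∀ {u w} → vertex u ≡ vertex w → u ≡ w
  vertex-injective {u} {w} eq = trans (sym (splitAt-join M M u)) (trans (cong (splitAt M) eq) (splitAt-join M M w))

  tail head : Fin (M * M + (M * d + M * d)) → Fin (M + M)
  tail = vertex ∘ tail′ ∘ arc
  head = vertex ∘ head′ ∘ arc

  simple : ∀ {e e′} → tail e ≡ tail e′ → head e ≡ head e′ → e ≡ e′
  simple {e} {e′} p q = arc-injective (arc-simple {arc e} {arc e′} (vertex-injective p) (vertex-injective q))

  no-2-cycle : ∀ {e e′} → tail e ≡ head e′ → head e ≡ tail e′ → ⊥
  no-2-cycle {e} {e′} p q = arc-no-2-cycle {arc e} {arc e′} (vertex-injective p) (vertex-injective q)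

  open ArcGraph tail head (λ e → tail′≢head′ (arc e) ∘ vertex-injective)
    (λ {e} {e′} → simple {e} {e′}) (λ {e} {e′} → no-2-cycle {e} {e′}) public

  complete : ∀ {u w} → u ≢ w → ∃ λ e → Joins e u w
  complete {u} {w} u≢w with arc-cover {splitAt M u} {splitAt M w} (u≢w ∘ splitAt-injective)
    where
    splitAt-injective : splitAt M u ≡ splitAt M w → u ≡ w
    splitAt-injective eq = trans (sym (join-splitAt M M u)) (trans (cong (join M M) eq) (join-splitAt M M w))
  ... | α , joins = e , Data.Sum.map (endpoints u w) (endpoints w u) joins
    where
    e : Fin (M * M + (M * d + M * d))
    e = Inverse.from arcIndex α
    onto : ∀ (f : Arc → Side) v → f α ≡ splitAt M v → vertex (f (arc e)) ≡ v
    onto f v eq = trans (cong (vertex ∘ f) (Inverse.strictlyInverseˡ arcIndex α))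
                        (trans (cong vertex eq) (join-splitAt M M v))
    endpoints : ∀ u w → tail′ α ≡ splitAt M u × head′ α ≡ splitAt M w → tail e ≡ u × head e ≡ w
    endpoints u w (t≡ , h≡) = onto tail′ u t≡ , onto head′ w h≡

  indegree-A : ∀ y → deg orientation (suc zero) (vertex (A y)) ≤ d
  indegree-A y = length-filter-allFin≤ (λ e → head e ≟ vertex (A y))
    (λ e p → inA-index (arc e) (vertex-injective p))
    (λ {e} {e′} p q eq → arc-injective (inA-index-injective (arc e) (arc e′) _ _ eq))

  outdegree-B : ∀ y → deg orientation zero (vertex (B y)) ≤ d
  outdegree-B y = length-filter-allFin≤ (λ e → tail e ≟ vertex (B y))
    (λ e p → outB-index (arc e) (vertex-injective p))
    (λ {e} {e′} p q eq → arc-injective (outB-index-injective (arc e) (arc e′) _ _ eq))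

  not-rich : ∀ v → ¬ (∀ i → suc d ≤ deg orientation i v)
  not-rich v rich with splitAt M v | join-splitAt M M v
  ... | A x | refl = <-irrefl refl (≤-trans (rich (suc zero)) (indegree-A x))
  ... | B y | refl = <-irrefl refl (≤-trans (rich zero) (outdegree-B y))

  no-rich-vertex : countRich orientation (suc d) ≡ 0
  no-rich-vertex = cong length
    (filter-none (λ v → all? (λ i → suc d ≤? deg orientation i v)) (tabulate⁺ not-rich))

[1+2d]+[1+2d]≡2[2d+1] : ∀ d → suc (d + d) + suc (d + d) ≡ 2 * (2 * d + 1)
[1+2d]+[1+2d]≡2[2d+1] = solve-∀

chromatic-bound-attained : (k : ℕ) → 1 ≤ k →
  Σ ℕ λ n → Σ (Hypergraph 2 n) λ G → Σ ℕ λ χ → Σ ℕ λ f →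
    IsChromaticNumber G χ × IsF1 G k f × (χ ≡ f + 2 * (2 * (k ∸ 1) + 1))
chromatic-bound-attained (suc d) _ =
  _ , graph , _ , 0 , complete⇒chromatic complete , ((orientation , no-rich-vertex) , λ _ → z≤n) , [1+2d]+[1+2d]≡2[2d+1] d
  where open SharpExample d

theorem6 :
    ((r n k : ℕ) (H : Hypergraph r n) → 1 ≤ k → (χ f : ℕ) →
      IsChromaticNumber H χ → IsF1 H k f →
      χ ≤ f + r * (r * (k ∸ 1) + 1))
    ×
    ((k : ℕ) → 1 ≤ k →
      Σ ℕ λ n → Σ (Hypergraph 2 n) λ G → Σ ℕ λ χ → Σ ℕ λ f →
        IsChromaticNumber G χ × IsF1 G k f × (χ ≡ f + 2 * (2 * (k ∸ 1) + 1)))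
theorem6 = chromatic-bound , chromatic-bound-attained
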